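{- Let $\mathcal T_n$ be a directed rooted tree on $n\ge 3$ nodes, either downward directed or upward directed, in which every non-leaf node has at least two children, and let $\chi_{\mathtt t}$ be its tree monitor placement. Then $\mu(\mathcal T_n\mid\chi_{\mathtt t})=1$ under either the $\mathrm{CSP}$ or the $\mathrm{CAP}^-$ routing mechanism.
   Context: A downward directed tree is a rooted tree with all edges directed from parent to child (the root is the only source, the leaves the only sinks); an upward directed tree has all edges directed from child to parent. The monitor placement $\chi_{\mathtt t}=(\mathfrak m,\mathfrak M)$ is: for a downward tree, $\mathfrak m=\{\text{root}\}$ and $\mathfrak M=$ the set of leaves; for an upward tree, $\mathfrak m=$ the set of leaves and $\mathfrak M=\{\text{root}\}$. The set of measurement paths $\mathbb P(G\mid\chi)$ (directed paths, following edge directions) depends on the routing mechanism: under $\mathrm{CSP}$ it consists of all simple directed paths from a node of $\mathfrak m$ to a different node of $\mathfrak M$; under $\mathrm{CAP}^-$ it consists of all directed walks starting at a node of $\mathfrak m$ and ending at a node of $\mathfrak M$, except single-node paths consisting of one node in $\mathfrak m\cap\mathfrak M$. For a node $v$, $\mathbb P(v)$ is the set of measurement paths through $v$, and $\mathbb P(U)=\bigcup_{u\in U}\mathbb P(u)$. $V$ is $k$-identifiable if for all $U,W\subseteq V$ with $U\neq W$ and $|U|,|W|\le k$, $\mathbb P(U)\neq\mathbb P(W)$. $\mu(G\mid\chi)$ is the largest $k\ge0$ such that $V$ is $k$-identifiable with respect to $\mathbb P(G\mid\chi)$. -}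

module Defs where

open import Data.Nat using (ℕ; zero; suc; _≤_)
open import Data.Fin using (Fin)
open import Data.Fin.Subset using (Subset; ∣_∣) renaming (_∈_ to _∈ₛ_)
open import Data.List using (List; []; _∷_)
open import Data.List.Membership.Propositional using () renaming (_∈_ to _∈ₗ_)
open import Data.List.Relation.Unary.Unique.Propositional using (Unique)
open import Data.Product using (Σ; ∃; ∃-syntax; _×_)
open import Relation.Binary.PropositionalEquality using (_≡_; _≢_)
open import Relation.Nullary using (¬_)

iter : {A : Set} → (A → A) → ℕ → A → A
iter f zero    x = x
iter f (suc k) x = f (iter f k x)

-- Convention: par root ≡ root (root has no parent); every node reaches the
-- root by iterating the parent map (hence no cycles other than at the root).
-- The (undirected) tree edges are {v , par v} for v ≢ root.
record RootedTree (n : ℕ) : Set where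
  field
    root     : Fin n
    par      : Fin n → Fin n
    par-root : par root ≡ root
    reaches  : ∀ v → ∃[ k ] iter par k v ≡ root

module _ {n : ℕ} (T : RootedTree n) where
  open RootedTree T

  Child : Fin n → Fin n → Set
  Child u c = c ≢ root × par c ≡ u

  Leaf : Fin n → Set
  Leaf u = ∀ c → ¬ Child u c

  AtLeastTwoChildren : Set
  AtLeastTwoChildren =
    ∀ u → ¬ Leaf u → ∃[ c₁ ] ∃[ c₂ ] (c₁ ≢ c₂ × Child u c₁ × Child u c₂)

data Orientation : Set where
  downward upward : Orientation

Edge : {n : ℕ} → Orientation → RootedTree n → Fin n → Fin n → Set
Edge downward T u v = Child T u v
Edge upward   T u v = Child T v u

record Placement (n : ℕ) : Set₁ where
  field
    𝔪 : Fin n → Set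
    𝔐 : Fin n → Set

χt : {n : ℕ} → Orientation → RootedTree n → Placement n
χt downward T = record { 𝔪 = λ v → v ≡ RootedTree.root T ; 𝔐 = Leaf T }
χt upward   T = record { 𝔪 = Leaf T ; 𝔐 = λ v → v ≡ RootedTree.root T }

-- directed walks from s to t, represented by their node sequence
data Walk {n : ℕ} (E : Fin n → Fin n → Set) : Fin n → Fin n → List (Fin n) → Set where
  single : ∀ v → Walk E v v (v ∷ [])
  step   : ∀ {u v t p} → E u v → Walk E v t p → Walk E u t (u ∷ p)

data Routing : Set where
  CSP CAP⁻ : Routing

MeasPath : {n : ℕ} → Routing → (Fin n → Fin n → Set) → Placement n → List (Fin n) → Set
MeasPath CSP  E χ p = ∃[ s ] ∃[ t ]
  (Placement.𝔪 χ s × Placement.𝔐 χ t × s ≢ t × Walk E s t p × Unique p)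
MeasPath CAP⁻ E χ p = ∃[ s ] ∃[ t ]
  (Placement.𝔪 χ s × Placement.𝔐 χ t × Walk E s t p
    × ¬ (p ≡ s ∷ [] × Placement.𝔪 χ s × Placement.𝔐 χ s))

PathsThrough : {n : ℕ} → (List (Fin n) → Set) → Subset n → List (Fin n) → Set
PathsThrough MP U p = MP p × ∃[ u ] (u ∈ₛ U × u ∈ₗ p)

_≐_ : {n : ℕ} → (List (Fin n) → Set) → (List (Fin n) → Set) → Set
P ≐ Q = ∀ p → (P p → Q p) × (Q p → P p)

Identifiable : {n : ℕ} → (List (Fin n) → Set) → ℕ → Set
Identifiable {n} MP k = ∀ (U W : Subset n) → ∣ U ∣ ≤ k → ∣ W ∣ ≤ k → U ≢ W →
  ¬ (PathsThrough MP U ≐ PathsThrough MP W)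

IsMaxIdentifiability : {n : ℕ} → (List (Fin n) → Set) → ℕ → Set
IsMaxIdentifiability MP k = Identifiable MP k × (∀ j → Identifiable MP j → j ≤ k)

-- The whole argument rests on one observation: for every leaf l the
-- directed root–l path is a measurement path, under both orientations and
-- both routings, and its node set is exactly the set of ancestors of l.
--
--  * μ ≥ 1.  If every leaf is covered (has an ancestor in the set) by U iff
--    it is covered by W, and |U|, |W| ≤ 1, then U = W.  This is pure tree
--    combinatorics: when every internal node has two children, any two
--    distinct nodes x, w are separated by a leaf lying below exactly one of
--    them (go down into a branch that avoids the other node).
--  * μ < 2.  Every measurement path passes through the root, so {root} and
--    {root, v} (v ≠ root) are crossed by the same paths.
module Submission where

open import Defs
open import Data.Nat using (ℕ; zero; suc; _+_; _*_; _∸_; _≤_; _<_; z≤n; s≤s)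
open import Data.Nat.Properties
  using (+-comm; +-suc; *-suc; +-identityʳ; m∸n+n≡m; ≤-total; ≤-trans; ≤-reflexive; n<1+n; n≤1+n)
open import Data.Fin using (Fin; zero; suc; toℕ)
open import Data.Fin.Properties using (pigeonhole; any?; 0≢1+n; toℕ<n) renaming (_≟_ to _≟F_)
open import Data.Fin.Subset using (Subset; ∣_∣; ⁅_⁆; _∪_; _⊆_; inside; outside) renaming (_∈_ to _∈ₛ_)
open import Data.Fin.Subset.Properties
  using (x∈⁅x⁆; x∈⁅y⁆⇒x≡y; ∣⁅x⁆∣≡1; p⊆p∪q; q⊆p∪q; ⊆-antisym) renaming (_∈?_ to _∈ₛ?_)
open import Data.List using (List; []; _∷_; _++_; [_])
open import Data.List.Membership.Propositional using () renaming (_∈_ to _∈ₗ_)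
open import Data.List.Membership.Propositional.Properties using (∈-++⁺ˡ; ∈-++⁺ʳ; ∈-++⁻)
import Data.List.Membership.DecPropositional as DecMembership
open import Data.List.Relation.Unary.Any using (here; there)
import Data.List.Relation.Unary.All as All
open import Data.List.Relation.Unary.AllPairs using ([]; _∷_)
open import Data.List.Relation.Unary.Unique.Propositional using (Unique)
open import Data.List.Relation.Unary.Unique.Propositional.Properties using (++⁺)
-- a Subset is a Vec of flags; membership is Vec's  _[_]=_
open import Data.Vec using ([]; _∷_; here; there)
open import Data.Product using (∃-syntax; _×_; _,_; proj₁; proj₂)
open import Data.Sum using (_⊎_; inj₁; inj₂; [_,_]′)
open import Data.Empty using (⊥; ⊥-elim)
open import Function.Bundles using (_⇔_; mk⇔; Equivalence)
open import Relation.Binary.PropositionalEquality using (_≡_; _≢_; refl; sym; trans; cong; cong₂; subst; module ≡-Reasoning)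
open import Relation.Nullary using (¬_; Dec; yes; no; contradiction)
open import Relation.Nullary.Decidable using (¬?; _×-dec_)
import Relation.Nullary.Decidable as Decidable

open Equivalence using (to; from)

iter-suc : {A : Set} (f : A → A) (k : ℕ) (x : A) → iter f (suc k) x ≡ iter f k (f x)
iter-suc f zero    x = refl
iter-suc f (suc k) x = cong f (iter-suc f k x)

iter-add : {A : Set} (f : A → A) (a b : ℕ) (x : A) → iter f (a + b) x ≡ iter f a (iter f b x)
iter-add f zero    b x = refl
iter-add f (suc a) b x = cong f (iter-add f a b x)

iter-fix : {A : Set} (f : A → A) (x : A) → f x ≡ x → ∀ k → iter f k x ≡ x
iter-fix f x fx≡x zero    = refl
iter-fix f x fx≡x (suc k) = trans (cong f (iter-fix f x fx≡x k)) fx≡x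

walk-start : ∀ {n} {E : Fin n → Fin n → Set} {s t p} → Walk E s t p → s ∈ₗ p
walk-start (single _) = here refl
walk-start (step _ _) = here refl

walk-end : ∀ {n} {E : Fin n → Fin n → Set} {s t p} → Walk E s t p → t ∈ₗ p
walk-end (single _) = here refl
walk-end (step _ w) = there (walk-end w)

walk-snoc : ∀ {n} {E : Fin n → Fin n → Set} {s t u p} → Walk E s t p → E t u → Walk E s u (p ++ [ u ])
walk-snoc (single _) e = step e (single _)
walk-snoc (step e′ w) e = step e′ (walk-snoc w e)

module Ancestry {n : ℕ} (T : RootedTree n) where
  open RootedTree T

  Anc : Fin n → Fin n → Set
  Anc y v = ∃[ e ] iter par e v ≡ y

  root-fix : ∀ k → iter par k root ≡ root
  root-fix = iter-fix par root par-root

  anc-trans : ∀ {x y z} → Anc x y → Anc y z → Anc x z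
  anc-trans {z = z} (a , ea) (b , eb) = a + b , trans (iter-add par a b z) (trans (cong (iter par a) eb) ea)

  child⇒anc : ∀ {x c} → Child T x c → Anc x c
  child⇒anc (_ , pc≡x) = 1 , pc≡x

  anc-via-parent : ∀ {y v} → Anc y (par v) → Anc y v
  anc-via-parent {v = v} (e , ee) = suc e , trans (iter-suc par e v) ee

  anc-cases : ∀ {y v} → Anc y v → y ≡ v ⊎ Anc y (par v)
  anc-cases             (zero  , ee) = inj₁ (sym ee)
  anc-cases {v = v} (suc e , ee) = inj₂ (e , trans (sym (iter-suc par e v)) ee)

  anc-root : ∀ {y} → Anc y root → y ≡ root
  anc-root (e , ee) = trans (sym ee) (root-fix e)

  periodic⇒root : ∀ i v → iter par (suc i) v ≡ v → v ≡ root
  periodic⇒root i v cyc with reaches v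
  ... | k , reach = begin
      v                          ≡⟨ sym (cycles k) ⟩
      iter par (k * suc i) v     ≡⟨ cong (λ m → iter par m v) (trans (*-suc k i) (+-comm k (k * i))) ⟩
      iter par (k * i + k) v     ≡⟨ iter-add par (k * i) k v ⟩
      iter par (k * i) (iter par k v) ≡⟨ cong (iter par (k * i)) reach ⟩
      iter par (k * i) root      ≡⟨ root-fix (k * i) ⟩
      root                       ∎
    where
      open ≡-Reasoning
      cycles : ∀ m → iter par (m * suc i) v ≡ v
      cycles zero    = refl
      cycles (suc m) = trans (iter-add par (suc i) (m * suc i) v)
                             (trans (cong (iter par (suc i)) (cycles m)) cyc)

  repeat⇒root : ∀ {a b} v → a < b → iter par a v ≡ iter par b v → iter par a v ≡ root
  repeat⇒root {a} {b} v a<b same = periodic⇒root d (iter par a v) (begin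
      iter par (suc d) (iter par a v) ≡⟨ sym (iter-add par (suc d) a v) ⟩
      iter par (suc d + a) v          ≡⟨ cong (λ m → iter par m v) (trans (sym (+-suc d a)) (m∸n+n≡m a<b)) ⟩
      iter par b v                    ≡⟨ sym same ⟩
      iter par a v                    ∎)
    where
      open ≡-Reasoning
      d = b ∸ suc a

  -- a non-root node is not an ancestor of its parent (so root–leaf walks are simple)
  not-anc-parent : ∀ {v} → v ≢ root → ¬ Anc v (par v)
  not-anc-parent {v} v≢root (e , ee) = v≢root (periodic⇒root e v (trans (iter-suc par e v) ee))

  anc-antisym : ∀ {x w} → Anc w x → Anc x w → x ≡ w
  anc-antisym (zero , ee) _ = ee
  anc-antisym {x} {w} (suc i , ee) (j , ee′) = trans x≡root (sym w≡root)
    where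
      x≡root : x ≡ root
      x≡root = periodic⇒root (j + i) x
        (trans (cong (λ m → iter par m x) (sym (+-suc j i)))
          (trans (iter-add par j (suc i) x) (trans (cong (iter par j) ee) ee′)))
      w≡root : w ≡ root
      w≡root = trans (sym ee) (trans (cong (iter par (suc i)) x≡root) (root-fix (suc i)))

  later-iterate-is-ancestor : ∀ {a b l y z} → a ≤ b → iter par a l ≡ y → iter par b l ≡ z → Anc z y
  later-iterate-is-ancestor {a} {b} {l} a≤b ea eb = b ∸ a ,
    trans (cong (iter par (b ∸ a)) (sym ea))
      (trans (sym (iter-add par (b ∸ a) a l)) (trans (cong (λ m → iter par m l) (m∸n+n≡m a≤b)) eb))

  anc-linear : ∀ {y z l} → Anc y l → Anc z l → Anc y z ⊎ Anc z y
  anc-linear (a , ea) (b , eb) with ≤-total a b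
  ... | inj₁ a≤b = inj₂ (later-iterate-is-ancestor a≤b ea eb)
  ... | inj₂ b≤a = inj₁ (later-iterate-is-ancestor b≤a eb ea)

  comparable-siblings : ∀ {x c c′} → Child T x c → Child T x c′ → Anc c c′ → c ≡ c′
  comparable-siblings _ _ (zero , ee) = sym ee
  comparable-siblings {x} {c} {c′} (c≢root , pc≡x) (_ , pc′≡x) (suc e , ee) =
    ⊥-elim (c≢root (trans (sym down) (trans (cong (iter par e) x≡root) (root-fix e))))
    where
      down : iter par e x ≡ c
      down = trans (cong (iter par e) (sym pc′≡x)) (trans (sym (iter-suc par e c′)) ee)
      x≡root : x ≡ root
      x≡root = periodic⇒root e x (trans (cong par down) pc≡x)

  siblings-disjoint : ∀ {x c c′ l} → Child T x c → Child T x c′ → c ≢ c′ → Anc c l → Anc c′ l → ⊥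
  siblings-disjoint ch ch′ c≢c′ acl ac′l with anc-linear acl ac′l
  ... | inj₁ acc′ = c≢c′ (comparable-siblings ch ch′ acc′)
  ... | inj₂ ac′c = c≢c′ (sym (comparable-siblings ch′ ch ac′c))

  child-towards : ∀ {x w} → x ≢ w → Anc x w → ∃[ c ] Child T x c × Anc c w
  child-towards x≢w (zero  , ee) = ⊥-elim (x≢w (sym ee))
  child-towards {x} {w} x≢w (suc i , ee) = go i ee
    where
      go : ∀ i → iter par (suc i) w ≡ x → ∃[ c ] Child T x c × Anc c w
      go i ee with iter par i w ≟F root
      ... | no  ≢root = iter par i w , (≢root , ee) , i , refl
      go zero    ee | yes ≡root = ⊥-elim (x≢w (trans (sym ee) (trans (cong par ≡root) (trans par-root (sym ≡root)))))
      go (suc i) ee | yes ≡root = go i (trans ≡root (trans (sym par-root) (trans (cong par (sym ≡root)) ee)))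

  depth-induction : (P : Fin n → Set) → P root → (∀ v → v ≢ root → P (par v) → P v) → ∀ v → P v
  depth-induction P base extend v = go (proj₁ (reaches v)) v (proj₂ (reaches v))
    where
      go : ∀ k v → iter par k v ≡ root → P v
      go zero    v ee = subst P (sym ee) base
      go (suc k) v ee with v ≟F root
      ... | yes v≡root = subst P (sym v≡root) base
      ... | no  v≢root = extend v v≢root (go k (par v) (trans (sym (iter-suc par k v)) ee))

  child? : ∀ u c → Dec (Child T u c)
  child? u c = ¬? (c ≟F root) ×-dec (par c ≟F u)

  leaf-or-child : ∀ u → Leaf T u ⊎ ∃[ c ] Child T u c
  leaf-or-child u with any? (child? u)
  ... | yes ch = inj₂ ch
  ... | no  no-child = inj₁ (λ c ch → no-child (c , ch))

  Depth≥ : ℕ → Fin n → Set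
  Depth≥ m c = ∀ i → i < m → iter par i c ≢ root

  -- By pigeonhole, some of the first n+1 iterates of c repeat, hence one is the root.
  depth-bounded : ∀ c → ¬ Depth≥ (suc n) c
  depth-bounded c deep with pigeonhole (n<1+n n) (λ i → iter par (toℕ i) c)
  ... | i , j , i<j , same = deep (toℕ i) (toℕ<n i) (repeat⇒root c i<j same)

  child-deeper : ∀ {m x c} → Depth≥ m x → Child T x c → Depth≥ (suc m) c
  child-deeper deep (c≢root , _) zero    _         = c≢root
  child-deeper {c = c} deep (_ , pc≡x) (suc i) (s≤s i<m) ≡root =
    deep i i<m (trans (cong (iter par i) (sym pc≡x)) (trans (sym (iter-suc par i c)) ≡root))

  -- Every node has a leaf below it: descend through children; the depth bound stops the descent.
  leaf-below : ∀ x → ∃[ l ] Leaf T l × Anc x l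
  leaf-below x = descend (suc n) x 0 (λ _ ()) (+-identityʳ (suc n))
    where
      descend : ∀ fuel x m → Depth≥ m x → fuel + m ≡ suc n → ∃[ l ] Leaf T l × Anc x l
      descend zero x m deep fuel+m≡ = ⊥-elim (depth-bounded x (subst (λ k → Depth≥ k x) fuel+m≡ deep))
      descend (suc fuel) x m deep fuel+m≡ with leaf-or-child x
      ... | inj₁ leaf = x , leaf , 0 , refl
      ... | inj₂ (c , ch) with descend fuel c (suc m) (child-deeper deep ch) (trans (+-suc fuel m) fuel+m≡)
      ... | l , leaf , acl = l , leaf , anc-trans (child⇒anc ch) acl

module AncestorWalks {n : ℕ} (T : RootedTree n) where
  open RootedTree T
  open Ancestry T

  SpansAncestors : List (Fin n) → Fin n → Set
  SpansAncestors p v = ∀ y → y ∈ₗ p ⇔ Anc y v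

  up-walk : ∀ v → ∃[ p ] Walk (Edge upward T) v root p × Unique p × SpansAncestors p v
  up-walk = depth-induction _ base extend
    where
      base : ∃[ p ] Walk (Edge upward T) root root p × Unique p × SpansAncestors p root
      base = [ root ] , single root , All.[] ∷ [] , λ y →
        mk⇔ (λ { (here refl) → 0 , refl ; (there ()) }) (λ a → here (anc-root a))
      extend : ∀ v → v ≢ root → ∃[ p ] Walk (Edge upward T) (par v) root p × Unique p × SpansAncestors p (par v)
                     → ∃[ p ] Walk (Edge upward T) v root p × Unique p × SpansAncestors p v
      extend v v≢root (p , w , uniq , spans) =
        v ∷ p , step (v≢root , refl) w ,
        All.tabulate (λ y∈p v≡y → not-anc-parent v≢root (to (spans _) (subst (_∈ₗ p) (sym v≡y) y∈p))) ∷ uniq ,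
        λ y → mk⇔ (λ { (here refl) → 0 , refl ; (there m) → anc-via-parent (to (spans y) m) })
                  (λ a → [ here , (λ a′ → there (from (spans y) a′)) ]′ (anc-cases a))

  down-walk : ∀ v → ∃[ p ] Walk (Edge downward T) root v p × Unique p × SpansAncestors p v
  down-walk = depth-induction _ base extend
    where
      base : ∃[ p ] Walk (Edge downward T) root root p × Unique p × SpansAncestors p root
      base = [ root ] , single root , All.[] ∷ [] , λ y →
        mk⇔ (λ { (here refl) → 0 , refl ; (there ()) }) (λ a → here (anc-root a))
      extend : ∀ v → v ≢ root → ∃[ p ] Walk (Edge downward T) root (par v) p × Unique p × SpansAncestors p (par v)
                     → ∃[ p ] Walk (Edge downward T) root v p × Unique p × SpansAncestors p v
      extend v v≢root (p , w , uniq , spans) =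
        p ++ [ v ] , walk-snoc w (v≢root , refl) ,
        ++⁺ uniq (All.[] ∷ []) (λ { (v∈p , here refl) → not-anc-parent v≢root (to (spans _) v∈p) }) ,
        λ y → mk⇔ (λ m → [ (λ m′ → anc-via-parent (to (spans y) m′)) , (λ { (here refl) → 0 , refl ; (there ()) }) ]′ (∈-++⁻ p m))
                  (λ a → [ (λ y≡v → ∈-++⁺ʳ p (here y≡v)) , (λ a′ → ∈-++⁺ˡ (from (spans y) a′)) ]′ (anc-cases a))

  anc? : ∀ y v → Dec (Anc y v)
  anc? y v with up-walk v
  ... | p , _ , _ , spans = Decidable.map (spans y) (DecMembership._∈?_ _≟F_ y p)

module Separation {n : ℕ} (T : RootedTree n) (two-children : AtLeastTwoChildren T) where
  open RootedTree T
  open Ancestry T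
  open AncestorWalks T

  another-child : ∀ {x c} → Child T x c → ∃[ c′ ] Child T x c′ × c′ ≢ c
  another-child {x} {c} ch with two-children x (λ leaf → leaf c ch)
  ... | c₁ , c₂ , c₁≢c₂ , ch₁ , ch₂ with c₁ ≟F c
  ... | yes c₁≡c = c₂ , ch₂ , λ c₂≡c → c₁≢c₂ (trans c₁≡c (sym c₂≡c))
  ... | no  c₁≢c = c₁ , ch₁ , c₁≢c

  branch-away : ∀ {x c} → Child T x c → ∃[ l ] Leaf T l × Anc x l × ¬ Anc c l
  branch-away ch with another-child ch
  ... | c′ , ch′ , c′≢c with leaf-below c′
  ... | l , leaf , ac′l = l , leaf , anc-trans (child⇒anc ch′) ac′l ,
                          λ acl → siblings-disjoint ch ch′ (λ e → c′≢c (sym e)) acl ac′l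

  leaf-below-not-below : ∀ {x w} → x ≢ w → ¬ Anc w x → ∃[ l ] Leaf T l × Anc x l × ¬ Anc w l
  leaf-below-not-below {x} {w} x≢w ¬awx with anc? x w
  ... | no ¬axw with leaf-below x
  ...   | l , leaf , axl = l , leaf , axl , λ awl → [ ¬awx , ¬axw ]′ (anc-linear awl axl)
  leaf-below-not-below {x} {w} x≢w ¬awx | yes axw with child-towards x≢w axw
  ... | c , ch , acw with branch-away ch
  ...   | l , leaf , axl , ¬acl = l , leaf , axl , λ awl → ¬acl (anc-trans acw awl)

  separating-leaf : ∀ {x w} → x ≢ w → ∃[ l ] Leaf T l × ((Anc x l × ¬ Anc w l) ⊎ (Anc w l × ¬ Anc x l))
  separating-leaf {x} {w} x≢w with anc? w x
  ... | no ¬awx with leaf-below-not-below x≢w ¬awx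
  ...   | l , leaf , axl , ¬awl = l , leaf , inj₁ (axl , ¬awl)
  separating-leaf {x} {w} x≢w | yes awx
    with leaf-below-not-below (λ w≡x → x≢w (sym w≡x)) (λ axw → x≢w (anc-antisym awx axw))
  ... | l , leaf , awl , ¬axl = l , leaf , inj₂ (awl , ¬axl)

size-nonempty : ∀ {n} {x : Fin n} (U : Subset n) → x ∈ₛ U → 1 ≤ ∣ U ∣
size-nonempty (inside  ∷ U) _         = s≤s z≤n
size-nonempty (outside ∷ U) (there m) = size-nonempty U m

at-most-one : ∀ {n} {x y : Fin n} (U : Subset n) → ∣ U ∣ ≤ 1 → x ∈ₛ U → y ∈ₛ U → x ≡ y
at-most-one (inside  ∷ U) _       here      here       = refl
at-most-one (inside  ∷ U) (s≤s h) here      (there m)  = contradiction (≤-trans (size-nonempty U m) h) λ ()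
at-most-one (inside  ∷ U) (s≤s h) (there m) _          = contradiction (≤-trans (size-nonempty U m) h) λ ()
at-most-one (outside ∷ U) h       (there m) (there m′) = cong suc (at-most-one U h m m′)

∣p∪q∣≤∣p∣+∣q∣ : ∀ {n} (p q : Subset n) → ∣ p ∪ q ∣ ≤ ∣ p ∣ + ∣ q ∣
∣p∪q∣≤∣p∣+∣q∣ []            []            = z≤n
∣p∪q∣≤∣p∣+∣q∣ (inside  ∷ p) (inside  ∷ q) =
  s≤s (≤-trans (∣p∪q∣≤∣p∣+∣q∣ p q) (≤-trans (n≤1+n _) (≤-reflexive (sym (+-suc ∣ p ∣ ∣ q ∣)))))
∣p∪q∣≤∣p∣+∣q∣ (inside  ∷ p) (outside ∷ q) = s≤s (∣p∪q∣≤∣p∣+∣q∣ p q)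
∣p∪q∣≤∣p∣+∣q∣ (outside ∷ p) (inside  ∷ q) =
  ≤-trans (s≤s (∣p∪q∣≤∣p∣+∣q∣ p q)) (≤-reflexive (sym (+-suc ∣ p ∣ ∣ q ∣)))
∣p∪q∣≤∣p∣+∣q∣ (outside ∷ p) (outside ∷ q) = ∣p∪q∣≤∣p∣+∣q∣ p q

another-node : ∀ {m} (r : Fin (suc (suc m))) → ∃[ v ] v ≢ r
another-node r with r ≟F zero
... | yes r≡0 = suc zero , λ 1≡r → 0≢1+n (sym (trans 1≡r r≡0))
... | no  r≢0 = zero , λ 0≡r → r≢0 (sym 0≡r)

module Measurement {n : ℕ} (T : RootedTree n) where
  open RootedTree T
  open Ancestry T
  open AncestorWalks T

  MP : Orientation → Routing → List (Fin n) → Set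
  MP o r = MeasPath r (Edge o T) (χt o T)

  root-on-path : ∀ o r p → MP o r p → root ∈ₗ p
  root-on-path downward CSP  p (_ , _ , refl , _ , _ , w , _) = walk-start w
  root-on-path downward CAP⁻ p (_ , _ , refl , _ , w , _)     = walk-start w
  root-on-path upward   CSP  p (_ , _ , _ , refl , _ , w , _) = walk-end w
  root-on-path upward   CAP⁻ p (_ , _ , _ , refl , w , _)     = walk-end w

  root≢leaf : ∀ {l} → ¬ Leaf T root → Leaf T l → root ≢ l
  root≢leaf root-internal leaf root≡l = root-internal (subst (Leaf T) (sym root≡l) leaf)

  leaf-path : ¬ Leaf T root → ∀ o r l → Leaf T l → ∃[ p ] MP o r p × SpansAncestors p l
  leaf-path root-internal downward CSP l leaf with down-walk l
  ...   | p , w , uniq , spans = p , (root , l , refl , leaf , root≢leaf root-internal leaf , w , uniq) , spans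
  leaf-path root-internal downward CAP⁻ l leaf with down-walk l
  ...   | p , w , _ , spans = p , (root , l , refl , leaf , w , λ { (_ , _ , root-leaf) → root-internal root-leaf }) , spans
  leaf-path root-internal upward CSP l leaf with up-walk l
  ...   | p , w , uniq , spans = p , (l , root , leaf , refl , (λ l≡root → root≢leaf root-internal leaf (sym l≡root)) , w , uniq) , spans
  leaf-path root-internal upward CAP⁻ l leaf with up-walk l
  ...   | p , w , _ , spans = p , (l , root , leaf , refl , w , λ { (_ , leaf′ , l≡root) → root-internal (subst (Leaf T) l≡root leaf′) }) , spans

  Covers : Subset n → Fin n → Set
  Covers U l = ∃[ u ] u ∈ₛ U × Anc u l

  -- If every path through U also passes through W, every leaf covered by U is
  -- covered by W: apply the hypothesis to the root–leaf path.
  cover-transfer : ¬ Leaf T root → ∀ o r {U W} → (∀ p → PathsThrough (MP o r) U p → PathsThrough (MP o r) W p) →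
                   ∀ l → Leaf T l → Covers U l → Covers W l
  cover-transfer root-internal o r U⇒W l leaf (u , u∈U , aul) with leaf-path root-internal o r l leaf
  ... | p , mp , spans with U⇒W p (mp , u , u∈U , from (spans u) aul)
  ...   | _ , w , w∈W , w∈p = w , w∈W , to (spans w) w∈p

module Identifiability {n : ℕ} (T : RootedTree n) (two-children : AtLeastTwoChildren T)
                       (v : Fin n) (v≢root : v ≢ RootedTree.root T) (o : Orientation) (r : Routing) where
  open RootedTree T
  open Ancestry T
  open Separation T two-children
  open Measurement T using (Covers; cover-transfer; root-on-path)

  MP : List (Fin n) → Set
  MP = Measurement.MP T o r

  -- the root is a proper ancestor of v, hence has a child
  root-internal : ¬ Leaf T root
  root-internal leaf with child-towards (λ root≡v → v≢root (sym root≡v)) (reaches v)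
  ... | c , ch , _ = leaf c ch

  -- For x ∈ U, a leaf below x is covered by some w ∈ W; if w ≠ x, a leaf
  -- separating x and w is covered by only one of U = {x} and W = {w}.
  same-cover⇒⊆ : ∀ U W → ∣ U ∣ ≤ 1 → ∣ W ∣ ≤ 1 →
                 (∀ l → Leaf T l → Covers U l → Covers W l) →
                 (∀ l → Leaf T l → Covers W l → Covers U l) → U ⊆ W
  same-cover⇒⊆ U W ∣U∣≤1 ∣W∣≤1 U⇒W W⇒U {x} x∈U with x ∈ₛ? W
  ... | yes x∈W = x∈W
  ... | no  x∉W with leaf-below x
  ...   | l₀ , leaf₀ , axl₀ with U⇒W l₀ leaf₀ (x , x∈U , axl₀)
  ...     | w , w∈W , _ with separating-leaf {x} {w} (λ x≡w → x∉W (subst (_∈ₛ W) (sym x≡w) w∈W))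
  ...       | l , leaf , inj₁ (axl , ¬awl) with U⇒W l leaf (x , x∈U , axl)
  ...         | w′ , w′∈W , aw′l = ⊥-elim (¬awl (subst (λ y → Anc y l) (at-most-one W ∣W∣≤1 w′∈W w∈W) aw′l))
  same-cover⇒⊆ U W ∣U∣≤1 ∣W∣≤1 U⇒W W⇒U {x} x∈U | no x∉W | _ | w , w∈W , _ | l , leaf , inj₂ (awl , ¬axl)
    with W⇒U l leaf (w , w∈W , awl)
  ... | u , u∈U , aul = ⊥-elim (¬axl (subst (λ y → Anc y l) (at-most-one U ∣U∣≤1 u∈U x∈U) aul))

  one-identifiable : Identifiable MP 1
  one-identifiable U W ∣U∣≤1 ∣W∣≤1 U≢W same =
    U≢W (⊆-antisym (same-cover⇒⊆ U W ∣U∣≤1 ∣W∣≤1 U⇒W W⇒U) (same-cover⇒⊆ W U ∣W∣≤1 ∣U∣≤1 W⇒U U⇒W))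
    where
      U⇒W = cover-transfer root-internal o r (λ p → proj₁ (same p))
      W⇒U = cover-transfer root-internal o r (λ p → proj₂ (same p))

  -- {root} and {root, v} are crossed by the same paths, since every path crosses the root.
  not-two-identifiable : ∀ j → Identifiable MP (suc (suc j)) → ⊥
  not-two-identifiable j ident = ident ⁅ root ⁆ (⁅ root ⁆ ∪ ⁅ v ⁆) ∣U∣≤ ∣W∣≤ U≢W same
    where
      ∣U∣≤ : ∣ ⁅ root ⁆ ∣ ≤ suc (suc j)
      ∣U∣≤ = ≤-trans (≤-reflexive (∣⁅x⁆∣≡1 root)) (s≤s z≤n)
      ∣W∣≤ : ∣ ⁅ root ⁆ ∪ ⁅ v ⁆ ∣ ≤ suc (suc j)
      ∣W∣≤ = ≤-trans (∣p∪q∣≤∣p∣+∣q∣ ⁅ root ⁆ ⁅ v ⁆)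
               (≤-trans (≤-reflexive (cong₂ _+_ (∣⁅x⁆∣≡1 root) (∣⁅x⁆∣≡1 v))) (s≤s (s≤s z≤n)))
      U≢W : ⁅ root ⁆ ≢ ⁅ root ⁆ ∪ ⁅ v ⁆
      U≢W U≡W = v≢root (x∈⁅y⁆⇒x≡y root (subst (v ∈ₛ_) (sym U≡W) (q⊆p∪q ⁅ root ⁆ ⁅ v ⁆ (x∈⁅x⁆ v))))
      same : PathsThrough MP ⁅ root ⁆ ≐ PathsThrough MP (⁅ root ⁆ ∪ ⁅ v ⁆)
      same p = (λ (mp , _) → mp , root , p⊆p∪q ⁅ v ⁆ (x∈⁅x⁆ root) , root-on-path o r p mp)
             , (λ (mp , _) → mp , root , x∈⁅x⁆ root , root-on-path o r p mp)

  at-most-one-identifiable : ∀ j → Identifiable MP j → j ≤ 1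
  at-most-one-identifiable zero          _     = z≤n
  at-most-one-identifiable (suc zero)    _     = s≤s z≤n
  at-most-one-identifiable (suc (suc j)) ident = ⊥-elim (not-two-identifiable j ident)

theorem2 : (n : ℕ) → 3 ≤ n → (T : RootedTree n) → AtLeastTwoChildren T →
    (o : Orientation) → (r : Routing) →
    IsMaxIdentifiability (MeasPath r (Edge o T) (χt o T)) 1
theorem2 (suc (suc (suc m))) (s≤s (s≤s (s≤s _))) T two-children o r
  with another-node (RootedTree.root T)
... | v , v≢root = one-identifiable , at-most-one-identifiable
  where open Identifiability T two-children v v≢root o r
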